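{- If $E$ is a light ceer with infinitely many classes, then $E$ is high for the computable FS-jump.
   Context: A ceer is an equivalence relation on $\mathbb N$ that is computably enumerable as a set of pairs. $E\leq F$ means there is a total computable $f$ with $x\mathrel{E}y\iff f(x)\mathrel{F}f(y)$; bireducible means reducible both ways. $\mathsf{id}$ is the identity on $\mathbb N$. A ceer $E$ is light if it has finitely many classes or $\mathsf{id}\leq E$. $\phi_e$ is the $e$-th partial computable function, $W_e$ its domain; $=^{ce}$ is the relation $e=^{ce}e'$ iff $W_e=W_{e'}$. The computable FS-jump is $E^+$ on $\mathbb N$ with $e\mathrel{E^+}e'$ iff $\{[\phi_e(n)]_E:\phi_e(n)\downarrow\}=\{[\phi_{e'}(n)]_E:\phi_{e'}(n)\downarrow\}$. A ceer $E$ is high for the computable FS-jump if $E^+$ is computably bireducible with $=^{ce}$. -}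

module Defs where

open import Data.Nat using (ℕ; zero; suc; _+_; _<_)
open import Data.Nat.DivMod using (_/_; _%_)
open import Data.Product using (Σ; ∃; _×_; _,_; proj₁; proj₂)
open import Data.Sum using (_⊎_)
open import Data.Maybe using (Maybe; just; nothing; _>>=_)
open import Relation.Binary.PropositionalEquality using (_≡_)
open import Relation.Binary.Core using (Rel)
open import Relation.Binary.Structures using (IsEquivalence)
open import Relation.Nullary using (¬_)
open import Function.Bundles using (_⇔_)
open import Level using (0ℓ)

tri : ℕ → ℕ
tri zero    = 0
tri (suc k) = suc k + tri k

pair : ℕ → ℕ → ℕ
pair x y = tri (x + y) + y

-- enumerates (0,0),(1,0),(0,1),(2,0),(1,1),(0,2),...
unpair : ℕ → ℕ × ℕ
unpair zero = (0 , 0)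
unpair (suc n) with unpair n
... | (zero  , y) = (suc y , 0)
... | (suc x , y) = (x , suc y)

-- A model of (unary) partial recursive functions on ℕ

data Code : Set where
  Z S I L R : Code                 -- const 0, successor, identity, left/right unpairing
  Comp      : Code → Code → Code   -- Comp f g = f ∘ g
  Pair      : Code → Code → Code   -- x ↦ ⟨f x , g x⟩
  Rec       : Code → Code → Code   -- h⟨x,0⟩ = f x ; h⟨x,y+1⟩ = g⟨⟨x,y⟩, h⟨x,y⟩⟩
  Mu        : Code → Code          -- x ↦ least y with f⟨x,y⟩ = 0 (all earlier defined)

mutual
  eval : ℕ → Code → ℕ → Maybe ℕ
  eval zero    _          _ = nothing
  eval (suc k) Z          x = just 0
  eval (suc k) S          x = just (suc x)
  eval (suc k) I          x = just x
  eval (suc k) L          x = just (proj₁ (unpair x))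
  eval (suc k) R          x = just (proj₂ (unpair x))
  eval (suc k) (Comp f g) x = eval k g x >>= eval k f
  eval (suc k) (Pair f g) x =
    eval k f x >>= λ a → eval k g x >>= λ b → just (pair a b)
  eval (suc k) (Rec f g)  x = evalRec k f g (proj₁ (unpair x)) (proj₂ (unpair x))
  eval (suc k) (Mu f)     x = search k f x k 0

  evalRec : ℕ → Code → Code → ℕ → ℕ → Maybe ℕ
  evalRec k f g x₀ zero     = eval k f x₀
  evalRec k f g x₀ (suc y)  =
    eval k (Rec f g) (pair x₀ y) >>= λ r → eval k g (pair (pair x₀ y) r)

  -- search for least y ≥ y₀ (within r more steps) with f⟨x,y⟩ = 0
  search : ℕ → Code → ℕ → ℕ → ℕ → Maybe ℕ
  search k f x zero    y = nothing
  search k f x (suc r) y = eval k f (pair x y) >>= λ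
    { zero    → just y
    ; (suc _) → search k f x r (suc y) }

-- Gödel numbering ℕ → Code (surjective), fuel-bounded for totality
decode′ : ℕ → ℕ → Code
decode′ zero    n = Z
decode′ (suc k) n with n % 9
... | 0 = Z
... | 1 = S
... | 2 = I
... | 3 = L
... | 4 = R
... | 5 = Comp (decode′ k (proj₁ (unpair (n / 9)))) (decode′ k (proj₂ (unpair (n / 9))))
... | 6 = Pair (decode′ k (proj₁ (unpair (n / 9)))) (decode′ k (proj₂ (unpair (n / 9))))
... | 7 = Rec  (decode′ k (proj₁ (unpair (n / 9)))) (decode′ k (proj₂ (unpair (n / 9))))
... | _ = Mu   (decode′ k (n / 9))

decode : ℕ → Code
decode n = decode′ n n

_·_⇓_ : ℕ → ℕ → ℕ → Set
e · x ⇓ v = ∃ λ k → eval k (decode e) x ≡ just v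

_·_↓ : ℕ → ℕ → Set
e · x ↓ = ∃ λ v → e · x ⇓ v

_∈W_ : ℕ → ℕ → Set
x ∈W e = e · x ↓

Computable : (ℕ → ℕ) → Set
Computable f = ∃ λ e → ∀ x → e · x ⇓ f x

IsCE : (ℕ → ℕ → Set) → Set
IsCE E = ∃ λ e → ∀ x y → (E x y ⇔ (pair x y ∈W e))

record IsCeer (E : Rel ℕ 0ℓ) : Set where
  field
    isEquivalence : IsEquivalence E
    isCE          : IsCE E

_≤c_ : Rel ℕ 0ℓ → Rel ℕ 0ℓ → Set
E ≤c F = ∃ λ f → Computable f × (∀ x y → (E x y ⇔ F (f x) (f y)))

Bireducible : Rel ℕ 0ℓ → Rel ℕ 0ℓ → Set
Bireducible E F = E ≤c F × F ≤c E

idℕ : Rel ℕ 0ℓ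
idℕ = _≡_

FinitelyManyClasses : Rel ℕ 0ℓ → Set
FinitelyManyClasses E = ∃ λ n → ∀ x → ∃ λ y → y < n × E x y

Light : Rel ℕ 0ℓ → Set
Light E = FinitelyManyClasses E ⊎ (idℕ ≤c E)

EqCE : Rel ℕ 0ℓ
EqCE e e′ = ∀ x → (x ∈W e ⇔ x ∈W e′)

Jump : Rel ℕ 0ℓ → Rel ℕ 0ℓ
Jump E e e′ =
    (∀ n v → e · n ⇓ v → ∃ λ m → ∃ λ w → e′ · m ⇓ w × E v w)
  × (∀ m w → e′ · m ⇓ w → ∃ λ n → ∃ λ v → e · n ⇓ v × E v w)

HighForJump : Rel ℕ 0ℓ → Set
HighForJump E = Bireducible (Jump E) EqCE

module Submission where

-- Being light and infinite, E admits a computable reduction f of id.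
--  * =ᶜᵉ ≤ E⁺ via g, where φ_{g e} is f restricted to W_e: the E-classes of
--    the values of φ_{g e} are {[f n] : n ∈ W_e}, which determine W_e.
--  * E⁺ ≤ =ᶜᵉ via h, where W_{h e} = {x : ∃ n, x E φ_e(n)} is the E-closure
--    of the range of φ_e; two such closures agree iff e E⁺ e′.  W_{h e} must be the domain of a μ-search over a TOTAL
-- program, so we build a primitive recursive checker for certificates
-- (lists of claims "φ_c(x) = v", each justified by claims later in the list)
-- and prove it sound and complete.

open import Defs
open import Relation.Binary.Core using (Rel)
open import Relation.Nullary using (¬_)
open import Level using (0ℓ)
open import Data.Nat
open import Data.Nat.Properties
open import Data.Nat.DivMod
open import Data.Nat.Divisibility using (n∣m*n)
open import Data.Product using (∃; _×_; _,_; proj₁; proj₂)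
open import Data.Sum using (_⊎_; inj₁; inj₂)
open import Data.Maybe using (Maybe; just; _>>=_)
open import Data.Maybe.Properties using (just-injective)
open import Data.List using (List; []; _∷_; length; _++_)
open import Data.List.Properties using (++-assoc)
open import Data.List.Relation.Unary.Any using (Any; here; there)
open import Data.List.Relation.Unary.Any.Properties using (++⁺ʳ)
open import Data.Unit using (⊤; tt)
open import Data.Empty using (⊥; ⊥-elim)
open import Relation.Binary.PropositionalEquality
open import Relation.Binary.Structures using (IsEquivalence)
open import Function.Bundles using (_⇔_; mk⇔; Equivalence)

π₁ π₂ : ℕ → ℕ
π₁ n = proj₁ (unpair n)
π₂ n = proj₂ (unpair n)

unpairStep : ℕ × ℕ → ℕ × ℕ
unpairStep (zero  , y) = (suc y , 0)
unpairStep (suc x , y) = (x , suc y)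

unpair-suc : ∀ n → unpair (suc n) ≡ unpairStep (unpair n)
unpair-suc n with unpair n
... | (zero  , y) = refl
... | (suc x , y) = refl

pair-sucʳ : ∀ x y → pair x (suc y) ≡ suc (pair (suc x) y)
pair-sucʳ x y rewrite +-suc x y = +-suc (tri (suc (x + y))) y

pair-suc-0 : ∀ x → pair (suc x) 0 ≡ suc (pair 0 x)
pair-suc-0 x rewrite +-identityʳ x | +-identityʳ (suc x + tri x) =
  cong suc (+-comm x (tri x))

pair-unpairStep : ∀ p → pair (proj₁ (unpairStep p)) (proj₂ (unpairStep p)) ≡ suc (pair (proj₁ p) (proj₂ p))
pair-unpairStep (zero  , y) = pair-suc-0 y
pair-unpairStep (suc x , y) = pair-sucʳ x y

pair≡0 : ∀ x y → pair x y ≡ 0 → x ≡ 0 × y ≡ 0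
pair≡0 zero    zero    eq = refl , refl
pair≡0 zero    (suc y) eq rewrite pair-sucʳ 0 y = ⊥-elim (1+n≢0 eq)
pair≡0 (suc x) zero    eq rewrite pair-suc-0 x = ⊥-elim (1+n≢0 eq)
pair≡0 (suc x) (suc y) eq rewrite pair-sucʳ (suc x) y = ⊥-elim (1+n≢0 eq)

unpair-pair′ : ∀ n x y → pair x y ≡ n → unpair n ≡ (x , y)
unpair-pair′ zero x y eq with pair≡0 x y eq
... | refl , refl = refl
unpair-pair′ (suc m) x (suc y) eq
  rewrite unpair-suc m | unpair-pair′ m (suc x) y (suc-injective (trans (sym (pair-sucʳ x y)) eq)) = refl
unpair-pair′ (suc m) (suc x) zero eq
  rewrite unpair-suc m | unpair-pair′ m 0 x (suc-injective (trans (sym (pair-suc-0 x)) eq)) = refl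
unpair-pair′ (suc m) zero zero ()

unpair-pair : ∀ x y → unpair (pair x y) ≡ (x , y)
unpair-pair x y = unpair-pair′ _ x y refl

π₁-pair : ∀ x y → π₁ (pair x y) ≡ x
π₁-pair x y = cong proj₁ (unpair-pair x y)

π₂-pair : ∀ x y → π₂ (pair x y) ≡ y
π₂-pair x y = cong proj₂ (unpair-pair x y)

pair-unpair : ∀ n → pair (π₁ n) (π₂ n) ≡ n
pair-unpair zero    = refl
pair-unpair (suc n) rewrite unpair-suc n =
  trans (pair-unpairStep (unpair n)) (cong suc (pair-unpair n))

-- Components are bounded by the code; this drives well-founded recursions
-- on codes (Gödel numbers, coded lists).
tri-≥ : ∀ n → n ≤ tri n
tri-≥ zero    = z≤n
tri-≥ (suc n) = m≤m+n (suc n) (tri n)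

x≤pair : ∀ x y → x ≤ pair x y
x≤pair x y = ≤-trans (m≤m+n x y) (≤-trans (tri-≥ (x + y)) (m≤m+n _ y))

y≤pair : ∀ x y → y ≤ pair x y
y≤pair x y = m≤n+m y (tri (x + y))

π₁-≤ : ∀ n → π₁ n ≤ n
π₁-≤ n = subst (π₁ n ≤_) (pair-unpair n) (x≤pair (π₁ n) (π₂ n))

π₂-≤ : ∀ n → π₂ n ≤ n
π₂-≤ n = subst (π₂ n ≤_) (pair-unpair n) (y≤pair (π₁ n) (π₂ n))

Evals : Code → ℕ → ℕ → Set
Evals c x v = ∃ λ k → eval k c x ≡ just v

Searches : Code → ℕ → ℕ → ℕ → Set
Searches f x y v = ∃ λ k → ∃ λ r → search k f x r y ≡ just v

bind≡just : ∀ {m : Maybe ℕ} {f : ℕ → Maybe ℕ} {v} → (m >>= f) ≡ just v →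
            ∃ λ a → m ≡ just a × f a ≡ just v
bind≡just {just a} eq = a , refl , eq

search-mono-r : ∀ k f x r y v → search k f x r y ≡ just v → search k f x (suc r) y ≡ just v
search-mono-r k f x (suc r) y v eq with bind≡just {eval k f (pair x y)} eq
... | zero  , e1 , e2 rewrite e1 = e2
... | suc a , e1 , e2 rewrite e1 = search-mono-r k f x r (suc y) v e2

mutual
  eval-mono : ∀ k c x v → eval k c x ≡ just v → eval (suc k) c x ≡ just v
  eval-mono (suc k) Z x v eq = eq
  eval-mono (suc k) S x v eq = eq
  eval-mono (suc k) I x v eq = eq
  eval-mono (suc k) L x v eq = eq
  eval-mono (suc k) R x v eq = eq
  eval-mono (suc k) (Comp f g) x v eq with bind≡just {eval k g x} eq
  ... | a , e1 , e2 rewrite eval-mono k g x a e1 = eval-mono k f a v e2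
  eval-mono (suc k) (Pair f g) x v eq with bind≡just {eval k f x} eq
  ... | a , e1 , e2 with bind≡just {eval k g x} e2
  ... | b , e3 , e4 rewrite eval-mono k f x a e1 | eval-mono k g x b e3 = e4
  eval-mono (suc k) (Rec f g) x v eq = evalRec-mono k f g (π₁ x) (π₂ x) v eq
  eval-mono (suc k) (Mu f) x v eq = search-mono-r (suc k) f x k 0 v (search-mono-k k f x k 0 v eq)

  evalRec-mono : ∀ k f g x₀ y v → evalRec k f g x₀ y ≡ just v → evalRec (suc k) f g x₀ y ≡ just v
  evalRec-mono k f g x₀ zero v eq = eval-mono k f x₀ v eq
  evalRec-mono k f g x₀ (suc y) v eq with bind≡just {eval k (Rec f g) (pair x₀ y)} eq
  ... | a , e1 , e2 rewrite eval-mono k (Rec f g) (pair x₀ y) a e1 = eval-mono k g _ v e2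

  search-mono-k : ∀ k f x r y v → search k f x r y ≡ just v → search (suc k) f x r y ≡ just v
  search-mono-k k f x (suc r) y v eq with bind≡just {eval k f (pair x y)} eq
  ... | zero  , e1 , e2 rewrite eval-mono k f (pair x y) 0 e1 = e2
  ... | suc a , e1 , e2 rewrite eval-mono k f (pair x y) (suc a) e1 = search-mono-k k f x r (suc y) v e2

eval-mono-≤ : ∀ {k k′} c x v → k ≤ k′ → eval k c x ≡ just v → eval k′ c x ≡ just v
eval-mono-≤ {k} c x v le eq with m≤n⇒∃[o]m+o≡n le
... | o , refl = go o
  where
  go : ∀ o → eval (k + o) c x ≡ just v
  go zero    rewrite +-identityʳ k = eq
  go (suc o) rewrite +-suc k o = eval-mono _ c x v (go o)

search-mono-≤ : ∀ {k k′ r r′} f x y v → k ≤ k′ → r ≤ r′ → search k f x r y ≡ just v → search k′ f x r′ y ≡ just v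
search-mono-≤ {k} {k′} {r} f x y v le₁ le₂ eq with m≤n⇒∃[o]m+o≡n le₁ | m≤n⇒∃[o]m+o≡n le₂
... | o₁ , refl | o₂ , refl = moreBudget o₂ (moreFuel o₁)
  where
  moreFuel : ∀ o → search (k + o) f x r y ≡ just v
  moreFuel zero    rewrite +-identityʳ k = eq
  moreFuel (suc o) rewrite +-suc k o = search-mono-k _ f x r y v (moreFuel o)
  moreBudget : ∀ o → search (k + o₁) f x r y ≡ just v → search (k + o₁) f x (r + o) y ≡ just v
  moreBudget zero    e rewrite +-identityʳ r = e
  moreBudget (suc o) e rewrite +-suc r o = search-mono-r (k + o₁) f x (r + o) y v (moreBudget o e)

comp-evals : ∀ A B x w v → Evals B x w → Evals A w v → Evals (Comp A B) x v
comp-evals A B x w v (k₁ , e1) (k₂ , e2) = suc (k₁ ⊔ k₂) , goal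
  where
  goal : eval (suc (k₁ ⊔ k₂)) (Comp A B) x ≡ just v
  goal rewrite eval-mono-≤ B x _ (m≤m⊔n k₁ k₂) e1 = eval-mono-≤ A _ _ (m≤n⊔m k₁ k₂) e2

pair-evals : ∀ A B x a b → Evals A x a → Evals B x b → Evals (Pair A B) x (pair a b)
pair-evals A B x a b (k₁ , e1) (k₂ , e2) = suc (k₁ ⊔ k₂) , goal
  where
  goal : eval (suc (k₁ ⊔ k₂)) (Pair A B) x ≡ just (pair a b)
  goal rewrite eval-mono-≤ A x _ (m≤m⊔n k₁ k₂) e1 | eval-mono-≤ B x _ (m≤n⊔m k₁ k₂) e2 = refl

rec-evals-0 : ∀ A B x v → π₂ x ≡ 0 → Evals A (π₁ x) v → Evals (Rec A B) x v
rec-evals-0 A B x v eq (k , e) = suc k , goal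
  where
  goal : eval (suc k) (Rec A B) x ≡ just v
  goal rewrite eq = e

rec-evals-suc : ∀ A B x y w v → π₂ x ≡ suc y → Evals (Rec A B) (pair (π₁ x) y) w →
                Evals B (pair (pair (π₁ x) y) w) v → Evals (Rec A B) x v
rec-evals-suc A B x y w v eq (k₁ , e1) (k₂ , e2) = suc (suc (k₁ ⊔ k₂)) , goal
  where
  goal : eval (suc (suc (k₁ ⊔ k₂))) (Rec A B) x ≡ just v
  goal rewrite eq | eval-mono-≤ (Rec A B) (pair (π₁ x) y) _ (≤-trans (m≤m⊔n k₁ k₂) (n≤1+n _)) e1
    = eval-mono-≤ B _ _ (≤-trans (m≤n⊔m k₁ k₂) (n≤1+n _)) e2

mu-evals : ∀ A x v → Searches A x 0 v → Evals (Mu A) x v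
mu-evals A x v (k , r , e) = suc (k ⊔ r) , search-mono-≤ A x 0 v (m≤m⊔n k r) (m≤n⊔m k r) e

search-found : ∀ f x y → Evals f (pair x y) 0 → Searches f x y y
search-found f x y (k , e) = k , 1 , goal
  where
  goal : search k f x 1 y ≡ just y
  goal rewrite e = refl

search-next : ∀ f x y z v → Evals f (pair x y) (suc z) → Searches f x (suc y) v → Searches f x y v
search-next f x y z v (k₁ , e1) (k₂ , r , e2) = k₁ ⊔ k₂ , suc r , goal
  where
  goal : search (k₁ ⊔ k₂) f x (suc r) y ≡ just v
  goal rewrite eval-mono-≤ f (pair x y) _ (m≤m⊔n k₁ k₂) e1 = search-mono-≤ {r = r} f x (suc y) v (m≤n⊔m k₁ k₂) ≤-refl e2

comp-evals⁻¹ : ∀ A B x v → Evals (Comp A B) x v → ∃ λ w → Evals B x w × Evals A w v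
comp-evals⁻¹ A B x v (suc k , ev) with bind≡just {eval k B x} ev
... | w , inner , outer = w , (k , inner) , (k , outer)

pair-evals⁻¹ : ∀ A B x v → Evals (Pair A B) x v → ∃ λ a → ∃ λ b → Evals A x a × Evals B x b × v ≡ pair a b
pair-evals⁻¹ A B x v (suc k , ev) with bind≡just {eval k A x} ev
... | a , left , ev′ with bind≡just {eval k B x} ev′
... | b , right , v≡ = a , b , (k , left) , (k , right) , sym (just-injective v≡)

I-evals⁻¹ : ∀ x v → Evals I x v → v ≡ x
I-evals⁻¹ x v (suc k , ev) = sym (just-injective ev)

L-evals⁻¹ : ∀ x v → Evals L x v → v ≡ π₁ x
L-evals⁻¹ x v (suc k , ev) = sym (just-injective ev)

evals-det : ∀ c x {a b} → Evals c x a → Evals c x b → a ≡ b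
evals-det c x (k , e) (k′ , e′) =
  just-injective (trans (sym (eval-mono-≤ c x _ (m≤m⊔n k k′) e)) (eval-mono-≤ c x _ (m≤n⊔m k k′) e′))

-- Restriction of F to the domain of D:  n ↦ F (π₁ ⟨n , D n⟩).
restrict : Code → Code → Code
restrict F D = Comp (Comp F L) (Pair I D)

restrict-evals : ∀ F D n w v → Evals D n w → Evals F n v → Evals (restrict F D) n v
restrict-evals F D n w v D↓ F↓ = comp-evals (Comp F L) (Pair I D) n (pair n w) v
  (pair-evals I D n n w (1 , refl) D↓) (comp-evals F L (pair n w) n v (1 , cong just (π₁-pair n w)) F↓)

restrict-evals⁻¹ : ∀ F D n v → Evals (restrict F D) n v → (∃ λ w → Evals D n w) × Evals F n v
restrict-evals⁻¹ F D n v r with comp-evals⁻¹ (Comp F L) (Pair I D) n v r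
... | p , paired , applied with pair-evals⁻¹ I D n p paired
... | a , b , a-evals , b-evals , refl with I-evals⁻¹ n a a-evals
... | refl with comp-evals⁻¹ F L (pair n b) v applied
... | c , c-evals , F-evals with trans (L-evals⁻¹ (pair n b) c c-evals) (π₁-pair n b)
... | refl = (b , b-evals) , F-evals

codeAt : ℕ → ℕ → Code
codeAt 0 q = Z
codeAt 1 q = S
codeAt 2 q = I
codeAt 3 q = L
codeAt 4 q = R
codeAt 5 q = Comp (decode (π₁ q)) (decode (π₂ q))
codeAt 6 q = Pair (decode (π₁ q)) (decode (π₂ q))
codeAt 7 q = Rec  (decode (π₁ q)) (decode (π₂ q))
codeAt _ q = Mu   (decode q)

payload-< : ∀ n → suc n / 9 ≤ n
payload-< n = s≤s⁻¹ (m/n<m (suc n) 9 (<ᵇ⇒< 1 9 _))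

decode′-stable : ∀ k k′ n → n ≤ k → n ≤ k′ → decode′ k n ≡ decode′ k′ n
decode′-stable zero    zero     n       _ _ = refl
decode′-stable zero    (suc k′) zero    _ _ = refl
decode′-stable (suc k) zero     zero    _ _ = refl
decode′-stable (suc k) (suc k′) zero    _ _ = refl
decode′-stable (suc k) (suc k′) (suc n) (s≤s n≤k) (s≤s n≤k′) = byTag
  where
  below : ∀ {m} → m ≤ suc n / 9 → decode′ k m ≡ decode′ k′ m
  below m≤q = decode′-stable k k′ _ (≤-trans m≤q (≤-trans (payload-< n) n≤k))
                                    (≤-trans m≤q (≤-trans (payload-< n) n≤k′))
  byTag : decode′ (suc k) (suc n) ≡ decode′ (suc k′) (suc n)
  byTag with suc n % 9
  ... | 0 = refl
  ... | 1 = refl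
  ... | 2 = refl
  ... | 3 = refl
  ... | 4 = refl
  ... | 5 = cong₂ Comp (below (π₁-≤ _)) (below (π₂-≤ _))
  ... | 6 = cong₂ Pair (below (π₁-≤ _)) (below (π₂-≤ _))
  ... | 7 = cong₂ Rec  (below (π₁-≤ _)) (below (π₂-≤ _))
  ... | suc (suc (suc (suc (suc (suc (suc (suc _))))))) = cong Mu (below ≤-refl)

decode-step : ∀ n → decode n ≡ codeAt (n % 9) (n / 9)
decode-step zero    = refl
decode-step (suc n) = byTag
  where
  below : ∀ {m} → m ≤ suc n / 9 → decode′ n m ≡ decode m
  below m≤q = decode′-stable n _ _ (≤-trans m≤q (payload-< n)) ≤-refl
  byTag : decode (suc n) ≡ codeAt (suc n % 9) (suc n / 9)
  byTag with suc n % 9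
  ... | 0 = refl
  ... | 1 = refl
  ... | 2 = refl
  ... | 3 = refl
  ... | 4 = refl
  ... | 5 = cong₂ Comp (below (π₁-≤ _)) (below (π₂-≤ _))
  ... | 6 = cong₂ Pair (below (π₁-≤ _)) (below (π₂-≤ _))
  ... | 7 = cong₂ Rec  (below (π₁-≤ _)) (below (π₂-≤ _))
  ... | suc (suc (suc (suc (suc (suc (suc (suc _))))))) = cong Mu (below ≤-refl)

decode-at : ∀ d q → d < 9 → decode (d + q * 9) ≡ codeAt d q
decode-at d q d<9 = trans (decode-step (d + q * 9)) (cong₂ codeAt tag payload)
  where
  tag : (d + q * 9) % 9 ≡ d
  tag = trans ([m+kn]%n≡m%n d q 9) (m<n⇒m%n≡m d<9)
  payload : (d + q * 9) / 9 ≡ q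
  payload = trans (+-distrib-/-∣ʳ d (n∣m*n q)) (cong₂ _+_ (m<n⇒m/n≡0 d<9) (m*n/n≡m q 9))

decode-Comp : ∀ a b → decode (5 + pair a b * 9) ≡ Comp (decode a) (decode b)
decode-Comp a b = trans (decode-at 5 (pair a b) (<ᵇ⇒< 5 9 _))
  (cong₂ (λ x y → Comp (decode x) (decode y)) (π₁-pair a b) (π₂-pair a b))

decode-Pair : ∀ a b → decode (6 + pair a b * 9) ≡ Pair (decode a) (decode b)
decode-Pair a b = trans (decode-at 6 (pair a b) (<ᵇ⇒< 6 9 _))
  (cong₂ (λ x y → Pair (decode x) (decode y)) (π₁-pair a b) (π₂-pair a b))

decode-Rec : ∀ a b → decode (7 + pair a b * 9) ≡ Rec (decode a) (decode b)
decode-Rec a b = trans (decode-at 7 (pair a b) (<ᵇ⇒< 7 9 _))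
  (cong₂ (λ x y → Rec (decode x) (decode y)) (π₁-pair a b) (π₂-pair a b))

decode-Mu : ∀ a → decode (8 + a * 9) ≡ Mu (decode a)
decode-Mu a = decode-at 8 a (<ᵇ⇒< 8 9 _)

enc : Code → ℕ
enc Z          = 0
enc S          = 1
enc I          = 2
enc L          = 3
enc R          = 4
enc (Comp a b) = 5 + pair (enc a) (enc b) * 9
enc (Pair a b) = 6 + pair (enc a) (enc b) * 9
enc (Rec a b)  = 7 + pair (enc a) (enc b) * 9
enc (Mu a)     = 8 + enc a * 9

decode-enc : ∀ c → decode (enc c) ≡ c
decode-enc Z          = refl
decode-enc S          = refl
decode-enc I          = refl
decode-enc L          = refl
decode-enc R          = refl
decode-enc (Comp a b) = trans (decode-Comp (enc a) (enc b)) (cong₂ Comp (decode-enc a) (decode-enc b))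
decode-enc (Pair a b) = trans (decode-Pair (enc a) (enc b)) (cong₂ Pair (decode-enc a) (decode-enc b))
decode-enc (Rec a b)  = trans (decode-Rec (enc a) (enc b)) (cong₂ Rec (decode-enc a) (decode-enc b))
decode-enc (Mu a)     = trans (decode-Mu (enc a)) (cong Mu (decode-enc a))

-- Primitive recursive programs

infixr 9 _∘p_
data PR : Set where
  zp sp ip lp rp : PR
  _∘p_   : PR → PR → PR
  ⟨_,_⟩p : PR → PR → PR
  recp   : PR → PR → PR

toCode : PR → Code
toCode zp         = Z
toCode sp         = S
toCode ip         = I
toCode lp         = L
toCode rp         = R
toCode (f ∘p g)   = Comp (toCode f) (toCode g)
toCode ⟨ f , g ⟩p = Pair (toCode f) (toCode g)
toCode (recp f g) = Rec (toCode f) (toCode g)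

mutual
  ⟦_⟧ : PR → ℕ → ℕ
  ⟦ zp ⟧         x = 0
  ⟦ sp ⟧         x = suc x
  ⟦ ip ⟧         x = x
  ⟦ lp ⟧         x = π₁ x
  ⟦ rp ⟧         x = π₂ x
  ⟦ f ∘p g ⟧     x = ⟦ f ⟧ (⟦ g ⟧ x)
  ⟦ ⟨ f , g ⟩p ⟧ x = pair (⟦ f ⟧ x) (⟦ g ⟧ x)
  ⟦ recp f g ⟧   x = ⟦rec⟧ f g (π₁ x) (π₂ x)

  ⟦rec⟧ : PR → PR → ℕ → ℕ → ℕ
  ⟦rec⟧ f g x₀ zero    = ⟦ f ⟧ x₀
  ⟦rec⟧ f g x₀ (suc y) = ⟦ g ⟧ (pair (pair x₀ y) (⟦rec⟧ f g x₀ y))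

rec-pair : ∀ f g x y → ⟦ recp f g ⟧ (pair x y) ≡ ⟦rec⟧ f g x y
rec-pair f g x y rewrite unpair-pair x y = refl

mutual
  pr-total : ∀ p x → Evals (toCode p) x (⟦ p ⟧ x)
  pr-total zp         x = 1 , refl
  pr-total sp         x = 1 , refl
  pr-total ip         x = 1 , refl
  pr-total lp         x = 1 , refl
  pr-total rp         x = 1 , refl
  pr-total (f ∘p g)   x = comp-evals (toCode f) (toCode g) x _ _ (pr-total g x) (pr-total f _)
  pr-total ⟨ f , g ⟩p x = pair-evals (toCode f) (toCode g) x _ _ (pr-total f x) (pr-total g x)
  pr-total (recp f g) x with rec-total f g (π₁ x) (π₂ x)
  ... | k , e = suc k , e

  rec-total : ∀ f g x₀ y → ∃ λ k → evalRec k (toCode f) (toCode g) x₀ y ≡ just (⟦rec⟧ f g x₀ y)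
  rec-total f g x₀ zero = pr-total f x₀
  rec-total f g x₀ (suc y) with rec-total f g x₀ y | pr-total g (pair (pair x₀ y) (⟦rec⟧ f g x₀ y))
  ... | k₁ , e1 | k₂ , e2 = suc (k₁ ⊔ k₂) , goal
    where
    previous : eval (suc k₁) (toCode (recp f g)) (pair x₀ y) ≡ just (⟦rec⟧ f g x₀ y)
    previous rewrite unpair-pair x₀ y = e1
    goal : evalRec (suc (k₁ ⊔ k₂)) (toCode f) (toCode g) x₀ (suc y) ≡ just (⟦rec⟧ f g x₀ (suc y))
    goal rewrite eval-mono-≤ (toCode (recp f g)) (pair x₀ y) _ (s≤s (m≤m⊔n k₁ k₂)) previous
      = eval-mono-≤ (toCode g) _ _ (≤-trans (m≤n⊔m k₁ k₂) (n≤1+n _)) e2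

iter : (ℕ → ℕ) → ℕ → ℕ → ℕ
iter f zero    a = a
iter f (suc n) a = f (iter f n a)

ifz : ℕ → ℕ → ℕ → ℕ
ifz zero    a b = a
ifz (suc _) a b = b

constP : ℕ → PR
constP zero    = zp
constP (suc n) = sp ∘p constP n

constP-correct : ∀ n x → ⟦ constP n ⟧ x ≡ n
constP-correct zero    x = refl
constP-correct (suc n) x = cong suc (constP-correct n x)

iterP : PR → PR
iterP st = recp ip (st ∘p rp)

iterP-correct : ∀ st (f : ℕ → ℕ) → (∀ y → ⟦ st ⟧ y ≡ f y) → ∀ a n → ⟦ iterP st ⟧ (pair a n) ≡ iter f n a
iterP-correct st f st≗f a n = trans (rec-pair ip (st ∘p rp) a n) (go n)
  where
  go : ∀ n → ⟦rec⟧ ip (st ∘p rp) a n ≡ iter f n a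
  go zero    = refl
  go (suc n) rewrite π₂-pair (pair a n) (⟦rec⟧ ip (st ∘p rp) a n) | go n = st≗f _

addP predP subP mulP : PR
addP  = iterP sp
predP = recp zp (rp ∘p lp) ∘p ⟨ zp , ip ⟩p
subP  = iterP predP
mulP  = recp zp (addP ∘p ⟨ rp , lp ∘p lp ⟩p)

addP-correct : ∀ a b → ⟦ addP ⟧ (pair a b) ≡ a + b
addP-correct a b = trans (iterP-correct sp suc (λ _ → refl) a b) (go b)
  where
  go : ∀ b → iter suc b a ≡ a + b
  go zero    = sym (+-identityʳ a)
  go (suc b) = trans (cong suc (go b)) (sym (+-suc a b))

predP-correct : ∀ y → ⟦ predP ⟧ y ≡ pred y
predP-correct y rewrite rec-pair zp (rp ∘p lp) 0 y with y
... | zero   = refl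
... | suc y′ rewrite π₁-pair (pair 0 y′) (⟦rec⟧ zp (rp ∘p lp) 0 y′) = π₂-pair 0 y′

subP-correct : ∀ a b → ⟦ subP ⟧ (pair a b) ≡ a ∸ b
subP-correct a b = trans (iterP-correct predP pred predP-correct a b) (go b)
  where
  go : ∀ b → iter pred b a ≡ a ∸ b
  go zero    = refl
  go (suc b) = trans (cong pred (go b)) (pred[m∸n]≡m∸[1+n] a b)

mulP-correct : ∀ a b → ⟦ mulP ⟧ (pair a b) ≡ a * b
mulP-correct a b = trans (rec-pair zp step a b) (go b)
  where
  step = addP ∘p ⟨ rp , lp ∘p lp ⟩p
  go : ∀ b → ⟦rec⟧ zp step a b ≡ a * b
  go zero = sym (*-zeroʳ a)
  go (suc b)
    rewrite π₂-pair (pair a b) (⟦rec⟧ zp step a b) | π₁-pair (pair a b) (⟦rec⟧ zp step a b) | π₁-pair a b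
          | addP-correct (⟦rec⟧ zp step a b) a | go b = trans (+-comm (a * b) a) (sym (*-suc a b))

ifzP : PR
ifzP = recp lp (rp ∘p lp ∘p lp)

ifzP-correct : ∀ a b t → ⟦ ifzP ⟧ (pair (pair a b) t) ≡ ifz t a b
ifzP-correct a b t rewrite rec-pair lp (rp ∘p lp ∘p lp) (pair a b) t with t
... | zero   = π₁-pair a b
... | suc t′ rewrite π₁-pair (pair (pair a b) t′) (⟦rec⟧ lp (rp ∘p lp ∘p lp) (pair a b) t′)
                   | π₁-pair (pair a b) t′ = π₂-pair a b

infixr 9 _∘ₑ_
infixl 7 _*ₑ_
infixl 6 _+ₑ_ _∸ₑ_
data Expr : Set where
  zₑ sₑ idₑ fstₑ sndₑ : Expr
  _∘ₑ_              : Expr → Expr → Expr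
  ⟨_,_⟩ₑ            : Expr → Expr → Expr
  _+ₑ_ _∸ₑ_ _*ₑ_    : Expr → Expr → Expr
  ifzₑ              : Expr → Expr → Expr → Expr
  constₑ            : ℕ → Expr
  iterₑ             : Expr → Expr → Expr → Expr   -- iterₑ step start count

⟦_⟧ₑ : Expr → ℕ → ℕ
⟦ zₑ ⟧ₑ           x = 0
⟦ sₑ ⟧ₑ           x = suc x
⟦ idₑ ⟧ₑ          x = x
⟦ fstₑ ⟧ₑ         x = π₁ x
⟦ sndₑ ⟧ₑ         x = π₂ x
⟦ f ∘ₑ g ⟧ₑ       x = ⟦ f ⟧ₑ (⟦ g ⟧ₑ x)
⟦ ⟨ f , g ⟩ₑ ⟧ₑ   x = pair (⟦ f ⟧ₑ x) (⟦ g ⟧ₑ x)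
⟦ a +ₑ b ⟧ₑ       x = ⟦ a ⟧ₑ x + ⟦ b ⟧ₑ x
⟦ a ∸ₑ b ⟧ₑ       x = ⟦ a ⟧ₑ x ∸ ⟦ b ⟧ₑ x
⟦ a *ₑ b ⟧ₑ       x = ⟦ a ⟧ₑ x * ⟦ b ⟧ₑ x
⟦ ifzₑ t a b ⟧ₑ   x = ifz (⟦ t ⟧ₑ x) (⟦ a ⟧ₑ x) (⟦ b ⟧ₑ x)
⟦ constₑ n ⟧ₑ     x = n
⟦ iterₑ st s n ⟧ₑ x = iter ⟦ st ⟧ₑ (⟦ n ⟧ₑ x) (⟦ s ⟧ₑ x)

compile : Expr → PR
compile zₑ             = zp
compile sₑ             = sp
compile idₑ            = ip
compile fstₑ           = lp
compile sndₑ           = rp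
compile (f ∘ₑ g)       = compile f ∘p compile g
compile ⟨ f , g ⟩ₑ     = ⟨ compile f , compile g ⟩p
compile (a +ₑ b)       = addP ∘p ⟨ compile a , compile b ⟩p
compile (a ∸ₑ b)       = subP ∘p ⟨ compile a , compile b ⟩p
compile (a *ₑ b)       = mulP ∘p ⟨ compile a , compile b ⟩p
compile (ifzₑ t a b)   = ifzP ∘p ⟨ ⟨ compile a , compile b ⟩p , compile t ⟩p
compile (constₑ n)     = constP n
compile (iterₑ st s n) = iterP (compile st) ∘p ⟨ compile s , compile n ⟩p

compile-correct : ∀ q x → ⟦ compile q ⟧ x ≡ ⟦ q ⟧ₑ x
compile-correct zₑ           x = refl
compile-correct sₑ           x = refl
compile-correct idₑ          x = refl
compile-correct fstₑ         x = refl
compile-correct sndₑ         x = refl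
compile-correct (f ∘ₑ g)     x rewrite compile-correct g x = compile-correct f _
compile-correct ⟨ f , g ⟩ₑ   x rewrite compile-correct f x | compile-correct g x = refl
compile-correct (a +ₑ b)     x rewrite compile-correct a x | compile-correct b x = addP-correct (⟦ a ⟧ₑ x) (⟦ b ⟧ₑ x)
compile-correct (a ∸ₑ b)     x rewrite compile-correct a x | compile-correct b x = subP-correct (⟦ a ⟧ₑ x) (⟦ b ⟧ₑ x)
compile-correct (a *ₑ b)     x rewrite compile-correct a x | compile-correct b x = mulP-correct (⟦ a ⟧ₑ x) (⟦ b ⟧ₑ x)
compile-correct (ifzₑ t a b) x
  rewrite compile-correct a x | compile-correct b x | compile-correct t x = ifzP-correct (⟦ a ⟧ₑ x) (⟦ b ⟧ₑ x) (⟦ t ⟧ₑ x)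
compile-correct (constₑ n)   x = constP-correct n x
compile-correct (iterₑ st s n) x rewrite compile-correct s x | compile-correct n x
  = iterP-correct (compile st) ⟦ st ⟧ₑ (compile-correct st) (⟦ s ⟧ₑ x) (⟦ n ⟧ₑ x)

exprCode : Expr → Code
exprCode q = toCode (compile q)

expr-total : ∀ q x → Evals (exprCode q) x (⟦ q ⟧ₑ x)
expr-total q x = subst (Evals (exprCode q) x) (compile-correct q x) (pr-total (compile q) x)

expr-computable : ∀ q → Computable ⟦ q ⟧ₑ
expr-computable q = enc (exprCode q) , λ x → subst (λ c → Evals c x (⟦ q ⟧ₑ x)) (sym (decode-enc (exprCode q))) (expr-total q x)

encList : List ℕ → ℕ
encList []      = 0
encList (e ∷ t) = suc (pair e (encList t))

length≤encList : ∀ ls → length ls ≤ encList ls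
length≤encList []      = z≤n
length≤encList (e ∷ t) = s≤s (≤-trans (length≤encList t) (y≤pair e (encList t)))

decList′ : ℕ → ℕ → List ℕ
decList′ zero    n       = []
decList′ (suc f) zero    = []
decList′ (suc f) (suc n) = π₁ n ∷ decList′ f (π₂ n)

encList-decList′ : ∀ f n → n ≤ f → encList (decList′ f n) ≡ n
encList-decList′ zero    zero    _         = refl
encList-decList′ (suc f) zero    _         = refl
encList-decList′ (suc f) (suc n) (s≤s n≤f)
  rewrite encList-decList′ f (π₂ n) (≤-trans (π₂-≤ n) n≤f) = cong suc (pair-unpair n)

decList : ℕ → List ℕ
decList n = decList′ n n

encList-decList : ∀ n → encList (decList n) ≡ n
encList-decList n = encList-decList′ n n ≤-refl

foldList : (ℕ → ℕ → ℕ → ℕ) → List ℕ → ℕ → ℕ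
foldList F []      a = a
foldList F (e ∷ t) a = foldList F t (F e (encList t) a)

iter-suc : ∀ g n a → iter g (suc n) a ≡ iter g n (g a)
iter-suc g zero    a = refl
iter-suc g (suc n) a = cong g (iter-suc g n a)

iter-fixed : ∀ g n a → g a ≡ a → iter g n a ≡ a
iter-fixed g zero    a ga≡a = refl
iter-fixed g (suc n) a ga≡a rewrite iter-fixed g n a ga≡a = ga≡a

iter-foldList : ∀ (step : ℕ → ℕ) F →
  (∀ a → step (pair 0 a) ≡ pair 0 a) →
  (∀ e T a → step (pair (suc (pair e T)) a) ≡ pair T (F e T a)) →
  ∀ ls a → iter step (encList ls) (pair (encList ls) a) ≡ pair 0 (foldList F ls a)
iter-foldList step F step-nil step-cons ls a = go ls (encList ls) a (length≤encList ls)
  where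
  go : ∀ ls n a → length ls ≤ n → iter step n (pair (encList ls) a) ≡ pair 0 (foldList F ls a)
  go []      n       a _ = iter-fixed step n _ (step-nil a)
  go (e ∷ t) (suc n) a (s≤s len≤n) = begin
    iter step (suc n) (pair (encList (e ∷ t)) a)  ≡⟨ iter-suc step n _ ⟩
    iter step n (step (pair (encList (e ∷ t)) a)) ≡⟨ cong (iter step n) (step-cons e (encList t) a) ⟩
    iter step n (pair (encList t) (F e (encList t) a)) ≡⟨ go t n _ len≤n ⟩
    pair 0 (foldList F (e ∷ t) a) ∎
    where open ≡-Reasoning

dist : ℕ → ℕ → ℕ
dist a b = (a ∸ b) + (b ∸ a)

dist≡0⇒≡ : ∀ a b → dist a b ≡ 0 → a ≡ b
dist≡0⇒≡ a b d≡0 = ≤-antisym (m∸n≡0⇒m≤n (m+n≡0⇒m≡0 (a ∸ b) d≡0)) (m∸n≡0⇒m≤n (m+n≡0⇒n≡0 (a ∸ b) d≡0))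

≡⇒dist≡0 : ∀ {a b} → a ≡ b → dist a b ≡ 0
≡⇒dist≡0 {a} refl rewrite n∸n≡0 a = refl

distₑ : Expr → Expr → Expr
distₑ a b = (a ∸ₑ b) +ₑ (b ∸ₑ a)

HasKey : ℕ → List ℕ → Set
HasKey k ls = Any (λ e → π₁ e ≡ k) ls

keyProduct : ℕ → List ℕ → ℕ → ℕ
keyProduct k []      f = f
keyProduct k (e ∷ t) f = keyProduct k t (f * dist (π₁ e) k)

keyProduct-0 : ∀ k ls → keyProduct k ls 0 ≡ 0
keyProduct-0 k []      = refl
keyProduct-0 k (e ∷ t) = keyProduct-0 k t

keyProduct≡0 : ∀ k ls f → keyProduct k ls f ≡ 0 → f ≡ 0 ⊎ HasKey k ls
keyProduct≡0 k []      f p≡0 = inj₁ p≡0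
keyProduct≡0 k (e ∷ t) f p≡0 with keyProduct≡0 k t _ p≡0
... | inj₂ has = inj₂ (there has)
... | inj₁ f·d≡0 with m*n≡0⇒m≡0∨n≡0 f f·d≡0
...   | inj₁ f≡0 = inj₁ f≡0
...   | inj₂ d≡0 = inj₂ (here (dist≡0⇒≡ _ _ d≡0))

HasKey⇒keyProduct≡0 : ∀ k ls f → HasKey k ls → keyProduct k ls f ≡ 0
HasKey⇒keyProduct≡0 k (e ∷ t) f (here refl)
  rewrite ≡⇒dist≡0 {π₁ e} refl | *-zeroʳ f = keyProduct-0 k t
HasKey⇒keyProduct≡0 k (e ∷ t) f (there has) = HasKey⇒keyProduct≡0 k t _ has

-- The membership test runs over states ⟨list , ⟨k , f⟩⟩.
memberStepₑ : Expr
memberStepₑ = ifzₑ list idₑ ⟨ sndₑ ∘ₑ cell , ⟨ key , acc *ₑ distₑ (fstₑ ∘ₑ fstₑ ∘ₑ cell) key ⟩ₑ ⟩ₑ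
  where
  list key acc cell : Expr
  list = fstₑ
  key  = fstₑ ∘ₑ sndₑ
  acc  = sndₑ ∘ₑ sndₑ
  cell = list ∸ₑ constₑ 1

memberTestₑ : Expr
memberTestₑ = sndₑ ∘ₑ sndₑ ∘ₑ iterₑ memberStepₑ ⟨ sndₑ , ⟨ fstₑ , constₑ 1 ⟩ₑ ⟩ₑ sndₑ

-- Kept opaque so that the larger expressions built from it below can be
-- related to their arithmetic specifications by computation.
opaque
  memberTest : ℕ → ℕ → ℕ
  memberTest k T = ⟦ memberTestₑ ⟧ₑ (pair k T)

memberF : ℕ → ℕ → ℕ → ℕ
memberF e T a = pair (π₁ a) (π₂ a * dist (π₁ e) (π₁ a))

memberStep-nil : ∀ a → ⟦ memberStepₑ ⟧ₑ (pair 0 a) ≡ pair 0 a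
memberStep-nil a rewrite π₁-pair 0 a = refl

memberStep-cons : ∀ e T a → ⟦ memberStepₑ ⟧ₑ (pair (suc (pair e T)) a) ≡ pair T (memberF e T a)
memberStep-cons e T a rewrite π₁-pair (suc (pair e T)) a | π₂-pair (suc (pair e T)) a
  | π₁-pair e T | π₂-pair e T = refl

foldList-member : ∀ k ls f → foldList memberF ls (pair k f) ≡ pair k (keyProduct k ls f)
foldList-member k []      f = refl
foldList-member k (e ∷ t) f rewrite π₁-pair k f | π₂-pair k f = foldList-member k t _

opaque
  unfolding memberTest

  memberTest-spec : ∀ k ls → memberTest k (encList ls) ≡ keyProduct k ls 1
  memberTest-spec k ls rewrite π₁-pair k (encList ls) | π₂-pair k (encList ls)
    | iter-foldList ⟦ memberStepₑ ⟧ₑ memberF memberStep-nil memberStep-cons ls (pair k 1)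
    | foldList-member k ls 1 | π₂-pair 0 (pair k (keyProduct k ls 1)) = π₂-pair k _

memberTest-sound : ∀ k ls → memberTest k (encList ls) ≡ 0 → HasKey k ls
memberTest-sound k ls t≡0 with keyProduct≡0 k ls 1 (trans (sym (memberTest-spec k ls)) t≡0)
... | inj₂ has = has

memberTest-complete : ∀ k ls → HasKey k ls → memberTest k (encList ls) ≡ 0
memberTest-complete k ls has = trans (memberTest-spec k ls) (HasKey⇒keyProduct≡0 k ls 1 has)

-- Certificates of convergence

-- Claims about the evaluator, coded as numbers:
--   evalClaim c x v      "decode c converges on x with value v",
--   searchClaim f x y v  "the μ-search of decode f on x started at y returns v".
evalClaim : ℕ → ℕ → ℕ → ℕ
evalClaim c x v = pair 0 (pair c (pair x v))

searchClaim : ℕ → ℕ → ℕ → ℕ → ℕ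
searchClaim f x y v = pair 1 (pair f (pair x (pair y v)))

Holds′ : ℕ → ℕ → Set
Holds′ 0             rest = Evals (decode (π₁ rest)) (π₁ (π₂ rest)) (π₂ (π₂ rest))
Holds′ 1             rest = Searches (decode (π₁ rest)) (π₁ (π₂ rest)) (π₁ (π₂ (π₂ rest))) (π₂ (π₂ (π₂ rest)))
Holds′ (suc (suc _)) rest = ⊥

Holds : ℕ → Set
Holds k = Holds′ (π₁ k) (π₂ k)

Holds-evalClaim : ∀ c x v → Holds (evalClaim c x v) ≡ Evals (decode c) x v
Holds-evalClaim c x v rewrite π₁-pair 0 (pair c (pair x v)) | π₂-pair 0 (pair c (pair x v))
  | π₁-pair c (pair x v) | π₂-pair c (pair x v) | π₁-pair x v | π₂-pair x v = refl

Holds-searchClaim : ∀ f x y v → Holds (searchClaim f x y v) ≡ Searches (decode f) x y v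
Holds-searchClaim f x y v rewrite π₁-pair 1 (pair f (pair x (pair y v))) | π₂-pair 1 (pair f (pair x (pair y v)))
  | π₁-pair f (pair x (pair y v)) | π₂-pair f (pair x (pair y v)) | π₁-pair x (pair y v) | π₂-pair x (pair y v)
  | π₁-pair y v | π₂-pair y v = refl

-- A certificate is a list of entries ⟨claim , hint⟩.  An entry is checked
-- against the code T of the rest of the list: the claim must follow by one
-- rule of the evaluator from claims listed in T.  Each check below is zero
-- exactly when it succeeds.
--
-- Evaluation claims on c = d + 9q (d ≤ 8) carry the hint ⟨d , ⟨q , w⟩⟩, w an
-- intermediate value for composition and recursion.
recPremises : ℕ → ℕ → ℕ → ℕ → ℕ → ℕ → ℕ → ℕ
recPremises c q x v w T y =
    ifz y (memberTest (evalClaim (π₁ q) (π₁ x) v) T)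
          (memberTest (evalClaim c x′ w) T + memberTest (evalClaim (π₂ q) (pair x′ w) v) T)
  where
  x′ : ℕ
  x′ = pair (π₁ x) (y ∸ 1)

nodeCheck : ℕ → ℕ → ℕ → ℕ → ℕ → ℕ → ℕ → ℕ
nodeCheck c x v d q w T =
    ifz d       v
    (ifz (d ∸ 1) (dist v (suc x))
    (ifz (d ∸ 2) (dist v x)
    (ifz (d ∸ 3) (dist v (π₁ x))
    (ifz (d ∸ 4) (dist v (π₂ x))
    (ifz (d ∸ 5) (listed (evalClaim (π₂ q) x w) + listed (evalClaim (π₁ q) w v))
    (ifz (d ∸ 6) (listed (evalClaim (π₁ q) x (π₁ v)) + listed (evalClaim (π₂ q) x (π₂ v)))
    (ifz (d ∸ 7) (recPremises c q x v w T (π₂ x))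
                 (listed (searchClaim q x 0 v)))))))))
  where
  listed : ℕ → ℕ
  listed k = memberTest k T

evalCheck : ℕ → ℕ → ℕ → ℕ → ℕ → ℕ → ℕ → ℕ
evalCheck c x v d q w T = dist c (d + q * 9) + ((d ∸ 8) + nodeCheck c x v d q w T)

-- Search claims carry the hint z = value of decode f at ⟨x , y⟩.
searchCheck : ℕ → ℕ → ℕ → ℕ → ℕ → ℕ → ℕ
searchCheck f x y v z T =
  memberTest (evalClaim f (pair x y) z) T + ifz z (dist v y) (memberTest (searchClaim f x (suc y) v) T)

claimCheck : ℕ → ℕ → ℕ → ℕ → ℕ
claimCheck tag rest h T =
  ifz tag (evalCheck (π₁ rest) (π₁ (π₂ rest)) (π₂ (π₂ rest)) (π₁ h) (π₁ (π₂ h)) (π₂ (π₂ h)) T)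
  (ifz (tag ∸ 1) (searchCheck (π₁ rest) (π₁ (π₂ rest)) (π₁ (π₂ (π₂ rest))) (π₂ (π₂ (π₂ rest))) h T) 1)

entryCheck : ℕ → ℕ → ℕ
entryCheck e T = claimCheck (π₁ (π₁ e)) (π₂ (π₁ e)) (π₂ e) T

evalClaimₑ : Expr → Expr → Expr → Expr
evalClaimₑ c x v = ⟨ constₑ 0 , ⟨ c , ⟨ x , v ⟩ₑ ⟩ₑ ⟩ₑ

searchClaimₑ : Expr → Expr → Expr → Expr → Expr
searchClaimₑ f x y v = ⟨ constₑ 1 , ⟨ f , ⟨ x , ⟨ y , v ⟩ₑ ⟩ₑ ⟩ₑ ⟩ₑ

listedₑ : Expr → Expr → Expr
listedₑ k T = memberTestₑ ∘ₑ ⟨ k , T ⟩ₑ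

entryCheckₑ : Expr
entryCheckₑ = ifzₑ tag evalCheckₑ (ifzₑ (tag ∸ₑ constₑ 1) searchCheckₑ (constₑ 1))
  where
  listed : Expr → Expr
  listed k = listedₑ k sndₑ
  claim hint tag rest : Expr
  claim = fstₑ ∘ₑ fstₑ
  hint  = sndₑ ∘ₑ fstₑ
  tag   = fstₑ ∘ₑ claim
  rest  = sndₑ ∘ₑ claim
  c x v d q w x′ : Expr
  c  = fstₑ ∘ₑ rest
  x  = fstₑ ∘ₑ sndₑ ∘ₑ rest
  v  = sndₑ ∘ₑ sndₑ ∘ₑ rest
  d  = fstₑ ∘ₑ hint
  q  = fstₑ ∘ₑ sndₑ ∘ₑ hint
  w  = sndₑ ∘ₑ sndₑ ∘ₑ hint
  x′ = ⟨ fstₑ ∘ₑ x , sndₑ ∘ₑ x ∸ₑ constₑ 1 ⟩ₑ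
  evalCheckₑ : Expr
  evalCheckₑ = distₑ c (d +ₑ q *ₑ constₑ 9) +ₑ ((d ∸ₑ constₑ 8) +ₑ
      ifzₑ d v
      (ifzₑ (d ∸ₑ constₑ 1) (distₑ v (sₑ ∘ₑ x))
      (ifzₑ (d ∸ₑ constₑ 2) (distₑ v x)
      (ifzₑ (d ∸ₑ constₑ 3) (distₑ v (fstₑ ∘ₑ x))
      (ifzₑ (d ∸ₑ constₑ 4) (distₑ v (sndₑ ∘ₑ x))
      (ifzₑ (d ∸ₑ constₑ 5) (listed (evalClaimₑ (sndₑ ∘ₑ q) x w) +ₑ listed (evalClaimₑ (fstₑ ∘ₑ q) w v))
      (ifzₑ (d ∸ₑ constₑ 6) (listed (evalClaimₑ (fstₑ ∘ₑ q) x (fstₑ ∘ₑ v)) +ₑ listed (evalClaimₑ (sndₑ ∘ₑ q) x (sndₑ ∘ₑ v)))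
      (ifzₑ (d ∸ₑ constₑ 7)
         (ifzₑ (sndₑ ∘ₑ x) (listed (evalClaimₑ (fstₑ ∘ₑ q) (fstₑ ∘ₑ x) v))
            (listed (evalClaimₑ c x′ w) +ₑ listed (evalClaimₑ (sndₑ ∘ₑ q) ⟨ x′ , w ⟩ₑ v)))
         (listed (searchClaimₑ q x (constₑ 0) v))))))))))
  y u : Expr
  y = fstₑ ∘ₑ sndₑ ∘ₑ sndₑ ∘ₑ rest
  u = sndₑ ∘ₑ sndₑ ∘ₑ sndₑ ∘ₑ rest
  searchCheckₑ : Expr
  searchCheckₑ = listed (evalClaimₑ c ⟨ x , y ⟩ₑ hint) +ₑ
                 ifzₑ hint (distₑ u y) (listed (searchClaimₑ c x (sₑ ∘ₑ y) u))

opaque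
  unfolding memberTest

  entryCheckₑ-correct : ∀ z → ⟦ entryCheckₑ ⟧ₑ z ≡ entryCheck (π₁ z) (π₂ z)
  entryCheckₑ-correct z = refl

Valid : List ℕ → Set
Valid []      = ⊤
Valid (e ∷ t) = entryCheck e (encList t) ≡ 0 × Valid t

validF : ℕ → ℕ → ℕ → ℕ
validF e T ok = ok + entryCheck e T

valid-sound : ∀ ls ok → foldList validF ls ok ≡ 0 → ok ≡ 0 × Valid ls
valid-sound []      ok f≡0 = f≡0 , tt
valid-sound (e ∷ t) ok f≡0 with valid-sound t _ f≡0
... | s≡0 , valid = m+n≡0⇒m≡0 ok s≡0 , m+n≡0⇒n≡0 ok s≡0 , valid

valid-complete : ∀ ls → Valid ls → foldList validF ls 0 ≡ 0
valid-complete []      _              = refl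
valid-complete (e ∷ t) (e≡0 , valid) rewrite e≡0 = valid-complete t valid

validStepₑ : Expr
validStepₑ = ifzₑ fstₑ idₑ ⟨ sndₑ ∘ₑ cell , sndₑ +ₑ entryCheckₑ ∘ₑ cell ⟩ₑ
  where
  cell : Expr
  cell = fstₑ ∸ₑ constₑ 1

validₑ : Expr
validₑ = sndₑ ∘ₑ iterₑ validStepₑ ⟨ idₑ , zₑ ⟩ₑ idₑ

-- The shape of validStepₑ for an arbitrary check F; keeping F abstract
-- avoids unfolding entryCheckₑ while computing.
checkStep : (ℕ → ℕ) → ℕ → ℕ
checkStep F s = ifz (π₁ s) s (pair (π₂ (π₁ s ∸ 1)) (π₂ s + F (π₁ s ∸ 1)))

checkStep-cons : ∀ F e T ok → checkStep F (pair (suc (pair e T)) ok) ≡ pair T (ok + F (pair e T))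
checkStep-cons F e T ok rewrite π₁-pair (suc (pair e T)) ok | π₂-pair (suc (pair e T)) ok | π₂-pair e T = refl

validStep-nil : ∀ ok → ⟦ validStepₑ ⟧ₑ (pair 0 ok) ≡ pair 0 ok
validStep-nil ok rewrite π₁-pair 0 ok = refl

validStep-cons : ∀ e T ok → ⟦ validStepₑ ⟧ₑ (pair (suc (pair e T)) ok) ≡ pair T (validF e T ok)
validStep-cons e T ok = trans (checkStep-cons ⟦ entryCheckₑ ⟧ₑ e T ok)
  (cong (λ z → pair T (ok + z)) (trans (entryCheckₑ-correct (pair e T)) (cong₂ entryCheck (π₁-pair e T) (π₂-pair e T))))

validₑ-spec : ∀ ls → ⟦ validₑ ⟧ₑ (encList ls) ≡ foldList validF ls 0
validₑ-spec ls = trans (cong π₂ (iter-foldList ⟦ validStepₑ ⟧ₑ validF validStep-nil validStep-cons ls 0)) (π₂-pair 0 _)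

-- Soundness: every claim listed in a valid certificate holds

+≡0 : ∀ {m n} → m + n ≡ 0 → m ≡ 0 × n ≡ 0
+≡0 {m} s = m+n≡0⇒m≡0 m s , m+n≡0⇒n≡0 m s

ListedHold : ℕ → Set
ListedHold T = ∀ k → memberTest k T ≡ 0 → Holds k

listed-evals : ∀ {T} → ListedHold T → ∀ c x v → memberTest (evalClaim c x v) T ≡ 0 → Evals (decode c) x v
listed-evals H c x v listed = subst (λ P → P) (Holds-evalClaim c x v) (H _ listed)

listed-searches : ∀ {T} → ListedHold T → ∀ f x y v → memberTest (searchClaim f x y v) T ≡ 0 → Searches (decode f) x y v
listed-searches H f x y v listed = subst (λ P → P) (Holds-searchClaim f x y v) (H _ listed)

rec-node-sound : ∀ {T} → ListedHold T → ∀ q x v w y → π₂ x ≡ y →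
  recPremises (7 + q * 9) q x v w T y ≡ 0 → Evals (codeAt 7 q) x v
rec-node-sound H q x v w zero x≡ listed = rec-evals-0 _ _ x v x≡ (listed-evals H (π₁ q) (π₁ x) v listed)
rec-node-sound H q x v w (suc y) x≡ listed with +≡0 listed
... | previous , step = rec-evals-suc _ _ x y w v x≡
        (subst (λ C → Evals C (pair (π₁ x) y) w) (decode-at 7 q (<ᵇ⇒< 7 9 _)) (listed-evals H _ _ _ previous))
        (listed-evals H (π₂ q) _ _ step)

nodeCheck-sound : ∀ {T} → ListedHold T → ∀ d q x v w → nodeCheck (d + q * 9) x v d q w T ≡ 0 → Evals (codeAt d q) x v
nodeCheck-sound H 0 q x v w ok = 1 , cong just (sym ok)
nodeCheck-sound H 1 q x v w ok = 1 , cong just (sym (dist≡0⇒≡ _ _ ok))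
nodeCheck-sound H 2 q x v w ok = 1 , cong just (sym (dist≡0⇒≡ _ _ ok))
nodeCheck-sound H 3 q x v w ok = 1 , cong just (sym (dist≡0⇒≡ _ _ ok))
nodeCheck-sound H 4 q x v w ok = 1 , cong just (sym (dist≡0⇒≡ _ _ ok))
nodeCheck-sound H 5 q x v w ok with +≡0 ok
... | inner , outer = comp-evals _ _ x w v (listed-evals H (π₂ q) x w inner) (listed-evals H (π₁ q) w v outer)
nodeCheck-sound H 6 q x v w ok with +≡0 ok
... | left , right = subst (Evals (codeAt 6 q) x) (pair-unpair v)
        (pair-evals _ _ x _ _ (listed-evals H (π₁ q) x (π₁ v) left) (listed-evals H (π₂ q) x (π₂ v) right))
nodeCheck-sound H 7 q x v w ok = rec-node-sound H q x v w (π₂ x) refl ok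
nodeCheck-sound H (suc (suc (suc (suc (suc (suc (suc (suc _)))))))) q x v w ok =
  mu-evals _ x v (listed-searches H q x 0 v ok)

evalCheck-sound : ∀ {T} → ListedHold T → ∀ c x v d q w → evalCheck c x v d q w T ≡ 0 → Evals (decode c) x v
evalCheck-sound H c x v d q w ok with +≡0 ok
... | c≡ , ok′ with +≡0 {d ∸ 8} ok′ | dist≡0⇒≡ c (d + q * 9) c≡
... | d≤8 , node | refl = subst (λ C → Evals C x v) (sym (decode-at d q (s≤s (m∸n≡0⇒m≤n d≤8))))
                                (nodeCheck-sound H d q x v w node)

searchCheck-sound : ∀ {T} → ListedHold T → ∀ f x y v z → searchCheck f x y v z T ≡ 0 → Searches (decode f) x y v
searchCheck-sound H f x y v z ok with +≡0 {memberTest (evalClaim f (pair x y) z) _} ok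
searchCheck-sound H f x y v zero    ok | value , v≡y with dist≡0⇒≡ v y v≡y
... | refl = search-found _ x y (listed-evals H f (pair x y) 0 value)
searchCheck-sound H f x y v (suc z) ok | value , later =
  search-next _ x y z v (listed-evals H f (pair x y) (suc z) value) (listed-searches H f x (suc y) v later)

claimCheck-sound : ∀ {T} → ListedHold T → ∀ tag rest h → claimCheck tag rest h T ≡ 0 → Holds′ tag rest
claimCheck-sound H zero             rest h ok = evalCheck-sound H (π₁ rest) _ _ (π₁ h) (π₁ (π₂ h)) (π₂ (π₂ h)) ok
claimCheck-sound H (suc zero)       rest h ok = searchCheck-sound H (π₁ rest) _ _ _ h ok
claimCheck-sound H (suc (suc tag)) rest h ()

certificate-sound : ∀ ls → Valid ls → ∀ k → HasKey k ls → Holds k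
certificate-sound (e ∷ t) (ok , valid) k (here refl) =
  claimCheck-sound (λ k′ listed → certificate-sound t valid k′ (memberTest-sound k′ t listed)) _ _ _ ok
certificate-sound (e ∷ t) (ok , valid) k (there has) = certificate-sound t valid k has

validₑ⇒ListedHold : ∀ ls → ⟦ validₑ ⟧ₑ (encList ls) ≡ 0 → ListedHold (encList ls)
validₑ⇒ListedHold ls accepted k listed =
  certificate-sound ls (proj₂ (valid-sound ls 0 (trans (sym (validₑ-spec ls)) accepted))) k (memberTest-sound k ls listed)

-- Completeness: every true claim has a certificate

Certifiable : ℕ → List ℕ → Set
Certifiable k l = ∃ λ l′ → Valid (l′ ++ l) × HasKey k (l′ ++ l)

-- Certificates are built in (at most) two stages, l₁ on top of l and l₂ on
-- top of that, and then closed by an entry for the new claim.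
certify : ∀ k e l₂ l₁ l → π₁ e ≡ k → entryCheck e (encList (l₂ ++ (l₁ ++ l))) ≡ 0 →
          Valid (l₂ ++ (l₁ ++ l)) → Certifiable k l
certify k e l₂ l₁ l e-key ok valid =
  e ∷ (l₂ ++ l₁) , subst (λ X → Valid (e ∷ X)) (sym (++-assoc l₂ l₁ l)) (ok , valid) , here e-key

entryCheck-eval : ∀ c x v d q w T → entryCheck (pair (evalClaim c x v) (pair d (pair q w))) T ≡ evalCheck c x v d q w T
entryCheck-eval c x v d q w T rewrite π₁-pair (evalClaim c x v) (pair d (pair q w)) | π₂-pair (evalClaim c x v) (pair d (pair q w))
  | π₁-pair 0 (pair c (pair x v)) | π₂-pair 0 (pair c (pair x v)) | π₁-pair c (pair x v) | π₂-pair c (pair x v)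
  | π₁-pair x v | π₂-pair x v | π₁-pair d (pair q w) | π₂-pair d (pair q w) | π₁-pair q w | π₂-pair q w = refl

entryCheck-search : ∀ f x y v z T → entryCheck (pair (searchClaim f x y v) z) T ≡ searchCheck f x y v z T
entryCheck-search f x y v z T rewrite π₁-pair (searchClaim f x y v) z | π₂-pair (searchClaim f x y v) z
  | π₁-pair 1 (pair f (pair x (pair y v))) | π₂-pair 1 (pair f (pair x (pair y v))) | π₁-pair f (pair x (pair y v))
  | π₂-pair f (pair x (pair y v)) | π₁-pair x (pair y v) | π₂-pair x (pair y v) | π₁-pair y v | π₂-pair y v = refl

certify-eval : ∀ d q x v w l₂ l₁ l → d < 9 →
  nodeCheck (d + q * 9) x v d q w (encList (l₂ ++ (l₁ ++ l))) ≡ 0 → Valid (l₂ ++ (l₁ ++ l)) →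
  Certifiable (evalClaim (d + q * 9) x v) l
certify-eval d q x v w l₂ l₁ l d<9 node valid =
  certify _ (pair (evalClaim (d + q * 9) x v) (pair d (pair q w))) l₂ l₁ l (π₁-pair _ _)
    (trans (entryCheck-eval _ x v d q w _) ok) valid
  where
  ok : evalCheck (d + q * 9) x v d q w (encList (l₂ ++ (l₁ ++ l))) ≡ 0
  ok rewrite ≡⇒dist≡0 {d + q * 9} refl | m≤n⇒m∸n≡0 (s≤s⁻¹ d<9) = node

certify-search : ∀ f x y v z l₂ l₁ l → searchCheck f x y v z (encList (l₂ ++ (l₁ ++ l))) ≡ 0 →
  Valid (l₂ ++ (l₁ ++ l)) → Certifiable (searchClaim f x y v) l
certify-search f x y v z l₂ l₁ l ok valid =
  certify _ (pair (searchClaim f x y v) z) l₂ l₁ l (π₁-pair _ z) (trans (entryCheck-search f x y v z _) ok) valid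

listed-below : ∀ k l₂ {L} → HasKey k L → memberTest k (encList (l₂ ++ L)) ≡ 0
listed-below k l₂ has = memberTest-complete k _ (++⁺ʳ l₂ has)

listed-top : ∀ k {L} → HasKey k L → memberTest k (encList L) ≡ 0
listed-top k has = memberTest-complete k _ has

recPremises-at : ∀ c q x v w T {y} → π₂ x ≡ y → recPremises c q x v w T y ≡ 0 → nodeCheck c x v 7 q w T ≡ 0
recPremises-at c q x v w T x≡ ok = subst (λ y → recPremises c q x v w T y ≡ 0) (sym x≡) ok

mutual
  certify-evals : ∀ k c x v → eval k (decode c) x ≡ just v → ∀ l → Valid l → Certifiable (evalClaim c x v) l
  certify-evals (suc k) c x v ev l valid =
    subst (λ c′ → Certifiable (evalClaim c′ x v) l) (sym (m≡m%n+[m/n]*n c 9))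
      (certify-node k (c % 9) (c / 9) x v (m%n<n c 9) (subst (λ C → eval (suc k) C x ≡ just v) (decode-step c) ev) l valid)

  certify-node : ∀ k d q x v → d < 9 → eval (suc k) (codeAt d q) x ≡ just v → ∀ l → Valid l →
                 Certifiable (evalClaim (d + q * 9) x v) l
  certify-node k 0 q x v d<9 ev l valid = certify-eval 0 q x v 0 [] [] l d<9 (sym (just-injective ev)) valid
  certify-node k 1 q x v d<9 ev l valid = certify-eval 1 q x v 0 [] [] l d<9 (≡⇒dist≡0 (sym (just-injective ev))) valid
  certify-node k 2 q x v d<9 ev l valid = certify-eval 2 q x v 0 [] [] l d<9 (≡⇒dist≡0 (sym (just-injective ev))) valid
  certify-node k 3 q x v d<9 ev l valid = certify-eval 3 q x v 0 [] [] l d<9 (≡⇒dist≡0 (sym (just-injective ev))) valid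
  certify-node k 4 q x v d<9 ev l valid = certify-eval 4 q x v 0 [] [] l d<9 (≡⇒dist≡0 (sym (just-injective ev))) valid
  certify-node k 5 q x v d<9 ev l valid with bind≡just {eval k (decode (π₂ q)) x} ev
  ... | w , inner , outer with certify-evals k (π₂ q) x w inner l valid
  ... | l₁ , valid₁ , has₁ with certify-evals k (π₁ q) w v outer (l₁ ++ l) valid₁
  ... | l₂ , valid₂ , has₂ =
    certify-eval 5 q x v w l₂ l₁ l d<9 (cong₂ _+_ (listed-below _ l₂ has₁) (listed-top _ has₂)) valid₂
  certify-node k 6 q x v d<9 ev l valid with bind≡just {eval k (decode (π₁ q)) x} ev
  ... | a , left , ev′ with bind≡just {eval k (decode (π₂ q)) x} ev′
  ... | b , right , v≡ with just-injective v≡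
  ... | refl with certify-evals k (π₁ q) x a left l valid
  ... | l₁ , valid₁ , has₁ with certify-evals k (π₂ q) x b right (l₁ ++ l) valid₁
  ... | l₂ , valid₂ , has₂ = certify-eval 6 q x (pair a b) 0 l₂ l₁ l d<9
          (cong₂ _+_ (subst (λ a′ → memberTest (evalClaim (π₁ q) x a′) _ ≡ 0) (sym (π₁-pair a b)) (listed-below _ l₂ has₁))
                     (subst (λ b′ → memberTest (evalClaim (π₂ q) x b′) _ ≡ 0) (sym (π₂-pair a b)) (listed-top _ has₂)))
          valid₂
  certify-node k 7 q x v d<9 ev l valid = certify-rec k q x v l valid (π₂ x) refl ev
  certify-node k 8 q x v d<9 ev l valid with certify-searches k k q x 0 v ev l valid
  ... | l₁ , valid₁ , has₁ = certify-eval 8 q x v 0 [] l₁ l d<9 (listed-top _ has₁) valid₁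
  certify-node k (suc (suc (suc (suc (suc (suc (suc (suc (suc d′))))))))) q x v d<9 ev l valid =
    ⊥-elim (<⇒≱ d<9 (m≤m+n 9 d′))

  certify-rec : ∀ k q x v l → Valid l → ∀ y → π₂ x ≡ y →
    evalRec k (decode (π₁ q)) (decode (π₂ q)) (π₁ x) y ≡ just v → Certifiable (evalClaim (7 + q * 9) x v) l
  certify-rec k q x v l valid zero x≡ ev with certify-evals k (π₁ q) (π₁ x) v ev l valid
  ... | l₁ , valid₁ , has₁ =
    certify-eval 7 q x v 0 [] l₁ l (<ᵇ⇒< 7 9 _) (recPremises-at (7 + q * 9) q x v 0 _ x≡ (listed-top _ has₁)) valid₁
  certify-rec k q x v l valid (suc y) x≡ ev
    with bind≡just {eval k (Rec (decode (π₁ q)) (decode (π₂ q))) (pair (π₁ x) y)} ev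
  ... | w , previous , step
    with certify-evals k (7 + q * 9) (pair (π₁ x) y) w
           (subst (λ C → eval k C (pair (π₁ x) y) ≡ just w) (sym (decode-at 7 q (<ᵇ⇒< 7 9 _))) previous) l valid
  ... | l₁ , valid₁ , has₁ with certify-evals k (π₂ q) (pair (pair (π₁ x) y) w) v step (l₁ ++ l) valid₁
  ... | l₂ , valid₂ , has₂ = certify-eval 7 q x v w l₂ l₁ l (<ᵇ⇒< 7 9 _)
          (recPremises-at (7 + q * 9) q x v w _ x≡ (cong₂ _+_ (listed-below _ l₂ has₁) (listed-top _ has₂))) valid₂

  certify-searches : ∀ k r f x y v → search k (decode f) x r y ≡ just v → ∀ l → Valid l →
                     Certifiable (searchClaim f x y v) l
  certify-searches k (suc r) f x y v ev l valid with bind≡just {eval k (decode f) (pair x y)} ev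
  ... | z , value , next with certify-evals k f (pair x y) z value l valid
  certify-searches k (suc r) f x y v ev l valid | zero , value , found | l₁ , valid₁ , has₁ with just-injective found
  ... | refl = certify-search f x y y 0 [] l₁ l (cong₂ _+_ (listed-top _ has₁) (≡⇒dist≡0 {y} refl)) valid₁
  certify-searches k (suc r) f x y v ev l valid | suc z , value , later | l₁ , valid₁ , has₁
    with certify-searches k r f x (suc y) v later (l₁ ++ l) valid₁
  ... | l₂ , valid₂ , has₂ =
    certify-search f x y v (suc z) l₂ l₁ l (cong₂ _+_ (listed-below _ l₂ has₁) (listed-top _ has₂)) valid₂

search-hits-zero : ∀ F x k r y v → search k (exprCode F) x r y ≡ just v → ∃ λ y′ → ⟦ F ⟧ₑ (pair x y′) ≡ 0
search-hits-zero F x k (suc r) y v ev with bind≡just {eval k (exprCode F) (pair x y)} ev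
... | a , value , next with evals-det (exprCode F) (pair x y) (k , value) (expr-total F (pair x y))
search-hits-zero F x k (suc r) y v ev | zero  , value , next | a≡ = y , sym a≡
search-hits-zero F x k (suc r) y v ev | suc a , value , next | a≡ = search-hits-zero F x k r (suc y) v next

searches-from : ∀ F x j y → ⟦ F ⟧ₑ (pair x (j + y)) ≡ 0 → ∃ λ v → Searches (exprCode F) x y v
searches-from F x zero y hit =
  y , search-found _ x y (subst (Evals _ _) hit (expr-total F (pair x y)))
searches-from F x (suc j) y hit with ⟦ F ⟧ₑ (pair x y) in value
... | zero  = y , search-found _ x y (subst (Evals _ _) value (expr-total F (pair x y)))
... | suc a with searches-from F x j (suc y) (subst (λ t → ⟦ F ⟧ₑ (pair x t) ≡ 0) (sym (+-suc j y)) hit)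
...   | v , later = v , search-next _ x y a v (subst (Evals _ _) value (expr-total F (pair x y))) later

mu-converges⇒zero : ∀ F x → (∃ λ v → Evals (Mu (exprCode F)) x v) → ∃ λ y → ⟦ F ⟧ₑ (pair x y) ≡ 0
mu-converges⇒zero F x (v , suc k , ev) = search-hits-zero F x k k 0 v ev

zero⇒mu-converges : ∀ F x → (∃ λ y → ⟦ F ⟧ₑ (pair x y) ≡ 0) → ∃ λ v → Evals (Mu (exprCode F)) x v
zero⇒mu-converges F x (y , hit) with searches-from F x y 0 (subst (λ t → ⟦ F ⟧ₑ (pair x t) ≡ 0) (sym (+-identityʳ y)) hit)
... | v , found = v , mu-evals _ x v found

-- An index for a given code; opaque so that indices of large codes are
-- never computed during type checking.
opaque
  indexOf : Code → ℕ
  indexOf c = enc c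

  decode-indexOf : ∀ c → decode (indexOf c) ≡ c
  decode-indexOf = decode-enc

Compₑ Pairₑ : Expr → Expr → Expr
Compₑ a b = constₑ 5 +ₑ ⟨ a , b ⟩ₑ *ₑ constₑ 9
Pairₑ a b = constₑ 6 +ₑ ⟨ a , b ⟩ₑ *ₑ constₑ 9

Muₑ : Expr → Expr
Muₑ a = constₑ 8 +ₑ a *ₑ constₑ 9

numeralₑ : Expr
numeralₑ = iterₑ (Compₑ (constₑ 1) idₑ) (constₑ 0) idₑ

decode-numeral : ∀ e → decode (⟦ numeralₑ ⟧ₑ e) ≡ toCode (constP e)
decode-numeral e = go e
  where
  go : ∀ n → decode (iter ⟦ Compₑ (constₑ 1) idₑ ⟧ₑ n 0) ≡ toCode (constP n)
  go zero    = refl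
  go (suc n) = trans (decode-Comp 1 (iter ⟦ Compₑ (constₑ 1) idₑ ⟧ₑ n 0)) (cong (Comp S) (go n))

smnₑ : Expr → Expr
smnₑ q = Compₑ (constₑ (indexOf (exprCode q))) (Pairₑ numeralₑ (constₑ 2))

decode-smn : ∀ q e → decode (⟦ smnₑ q ⟧ₑ e) ≡ exprCode (q ∘ₑ ⟨ constₑ e , idₑ ⟩ₑ)
decode-smn q e = trans (decode-Comp (indexOf (exprCode q)) _)
  (cong₂ Comp (decode-indexOf (exprCode q)) (trans (decode-Pair (⟦ numeralₑ ⟧ₑ e) 2) (cong₂ Pair (decode-numeral e) refl)))

decode-muSmn : ∀ q e → decode (⟦ Muₑ (smnₑ q) ⟧ₑ e) ≡ Mu (exprCode (q ∘ₑ ⟨ constₑ e , idₑ ⟩ₑ))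
decode-muSmn q e = trans (decode-Mu (⟦ smnₑ q ⟧ₑ e)) (cong Mu (decode-smn q e))

-- E⁺ ≤ =ᶜᵉ for every ceer E

Closure : Rel ℕ 0ℓ → ℕ → ℕ → Set
Closure E e x = ∃ λ n → ∃ λ v → e · n ⇓ v × E x v

module ClosureFacts (E : Rel ℕ 0ℓ) (isEquivalence : IsEquivalence E) where
  open IsEquivalence isEquivalence using () renaming (refl to E-refl; sym to E-sym; trans to E-trans)

  jump-sym : ∀ e e′ → Jump E e e′ → Jump E e′ e
  jump-sym e e′ (forth , back) =
    (λ m w value → let (n , v , value′ , vEw) = back m w value in n , v , value′ , E-sym vEw) ,
    (λ n v value → let (m , w , value′ , vEw) = forth n v value in m , w , value′ , E-sym vEw)

  jump⇒⊆ : ∀ e e′ x → Jump E e e′ → Closure E e x → Closure E e′ x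
  jump⇒⊆ e e′ x (forth , _) (n , v , value , xEv) =
    let (m , w , value′ , vEw) = forth n v value in m , w , value′ , E-trans xEv vEw

  closures⇒jump : ∀ e e′ → (∀ x → Closure E e x ⇔ Closure E e′ x) → Jump E e e′
  closures⇒jump e e′ same =
    (λ n v value → Equivalence.to (same v) (n , v , value , E-refl)) ,
    (λ m w value → let (n , v , value′ , wEv) = Equivalence.from (same w) (m , w , value , E-refl)
                   in n , v , value′ , E-sym wEv)

-- Membership in the closure is witnessed by t = ⟨⟨n , ⟨v , u⟩⟩ , T⟩, where T
-- codes a valid certificate listing φ_e(n) = v and φ_eE(⟨x , v⟩) = u, eE
-- enumerating E.
closureCheck : ℕ → ℕ → ℕ → ℕ → ℕ → ℕ → ℕ → ℕ
closureCheck eE e x n v u T =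
  ⟦ validₑ ⟧ₑ T + (memberTest (evalClaim e n v) T + memberTest (evalClaim eE (pair x v) u) T)

closureCheck′ : ℕ → ℕ → ℕ → ℕ → ℕ
closureCheck′ eE e x t = closureCheck eE e x (π₁ (π₁ t)) (π₁ (π₂ (π₁ t))) (π₂ (π₂ (π₁ t))) (π₂ t)

closureCheckₑ : ℕ → Expr
closureCheckₑ eE = validₑ ∘ₑ T +ₑ (listedₑ (evalClaimₑ e n v) T +ₑ listedₑ (evalClaimₑ (constₑ eE) ⟨ x , v ⟩ₑ u) T)
  where
  e x t T w n v u : Expr
  e = fstₑ
  x = fstₑ ∘ₑ sndₑ
  t = sndₑ ∘ₑ sndₑ
  T = sndₑ ∘ₑ t
  w = fstₑ ∘ₑ t
  n = fstₑ ∘ₑ w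
  v = fstₑ ∘ₑ sndₑ ∘ₑ w
  u = sndₑ ∘ₑ sndₑ ∘ₑ w

closureₑ : ℕ → ℕ → Expr
closureₑ eE e = closureCheckₑ eE ∘ₑ ⟨ constₑ e , idₑ ⟩ₑ

opaque
  unfolding memberTest

  closureₑ-correct : ∀ eE e z → ⟦ closureₑ eE e ⟧ₑ z ≡ closureCheck′ eE (π₁ (pair e z)) (π₁ (π₂ (pair e z))) (π₂ (π₂ (pair e z)))
  closureₑ-correct eE e z = refl

closureₑ-at : ∀ eE e x t → ⟦ closureₑ eE e ⟧ₑ (pair x t) ≡ closureCheck′ eE e x t
closureₑ-at eE e x t = begin
  ⟦ closureₑ eE e ⟧ₑ (pair x t)
    ≡⟨ closureₑ-correct eE e (pair x t) ⟩
  closureCheck′ eE (π₁ (pair e (pair x t))) (π₁ (π₂ (pair e (pair x t)))) (π₂ (π₂ (pair e (pair x t))))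
    ≡⟨ cong₂ (λ a b → closureCheck′ eE a (π₁ b) (π₂ b)) (π₁-pair e (pair x t)) (π₂-pair e (pair x t)) ⟩
  closureCheck′ eE e (π₁ (pair x t)) (π₂ (pair x t))
    ≡⟨ cong₂ (closureCheck′ eE e) (π₁-pair x t) (π₂-pair x t) ⟩
  closureCheck′ eE e x t ∎
  where open ≡-Reasoning

closureCheck′-pair : ∀ eE e x n v u T → closureCheck′ eE e x (pair (pair n (pair v u)) T) ≡ closureCheck eE e x n v u T
closureCheck′-pair eE e x n v u T = begin
  closureCheck′ eE e x (pair (pair n (pair v u)) T)
    ≡⟨ cong₂ (λ a b → closureCheck eE e x (π₁ a) (π₁ (π₂ a)) (π₂ (π₂ a)) b) (π₁-pair (pair n (pair v u)) T) (π₂-pair (pair n (pair v u)) T) ⟩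
  closureCheck eE e x (π₁ (pair n (pair v u))) (π₁ (π₂ (pair n (pair v u)))) (π₂ (π₂ (pair n (pair v u)))) T
    ≡⟨ cong₂ (λ a b → closureCheck eE e x a (π₁ b) (π₂ b) T) (π₁-pair n (pair v u)) (π₂-pair n (pair v u)) ⟩
  closureCheck eE e x n (π₁ (pair v u)) (π₂ (pair v u)) T
    ≡⟨ cong₂ (λ a b → closureCheck eE e x n a b T) (π₁-pair v u) (π₂-pair v u) ⟩
  closureCheck eE e x n v u T ∎
  where open ≡-Reasoning

closureCheck-sound : ∀ eE e x n v u T → closureCheck eE e x n v u T ≡ 0 →
                     Evals (decode e) n v × Evals (decode eE) (pair x v) u
closureCheck-sound eE e x n v u T ok =
  sound (decList T) (subst (λ T′ → closureCheck eE e x n v u T′ ≡ 0) (sym (encList-decList T)) ok)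
  where
  sound : ∀ ls → closureCheck eE e x n v u (encList ls) ≡ 0 → Evals (decode e) n v × Evals (decode eE) (pair x v) u
  sound ls ok with +≡0 ok
  ... | accepted , listed with +≡0 listed
  ... | listed₁ , listed₂ =
    listed-evals (validₑ⇒ListedHold ls accepted) e n v listed₁ ,
    listed-evals (validₑ⇒ListedHold ls accepted) eE (pair x v) u listed₂

closureCheck-complete : ∀ eE e x n v u → Evals (decode e) n v → Evals (decode eE) (pair x v) u →
                        ∃ λ T → closureCheck eE e x n v u T ≡ 0
closureCheck-complete eE e x n v u (k₁ , ev₁) (k₂ , ev₂) with certify-evals k₁ e n v ev₁ [] tt
... | l₁ , valid₁ , has₁ with certify-evals k₂ eE (pair x v) u ev₂ (l₁ ++ []) valid₁
... | l₂ , valid₂ , has₂ = encList ls ,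
  cong₂ _+_ (trans (validₑ-spec ls) (valid-complete ls valid₂)) (cong₂ _+_ (listed-below _ l₂ has₁) (listed-top _ has₂))
  where
  ls : List ℕ
  ls = l₂ ++ (l₁ ++ [])

module ClosureIndex (E : Rel ℕ 0ℓ) (eE : ℕ) (enumerates : ∀ x y → E x y ⇔ (pair x y ∈W eE)) where

  closure-sound : ∀ e x t → ⟦ closureₑ eE e ⟧ₑ (pair x t) ≡ 0 → Closure E e x
  closure-sound e x t ok = n , v , proj₁ evals , Equivalence.from (enumerates x v) (u , proj₂ evals)
    where
    n v u : ℕ
    n = π₁ (π₁ t)
    v = π₁ (π₂ (π₁ t))
    u = π₂ (π₂ (π₁ t))
    evals : Evals (decode e) n v × Evals (decode eE) (pair x v) u
    evals = closureCheck-sound eE e x n v u (π₂ t) (trans (sym (closureₑ-at eE e x t)) ok)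

  closure-complete : ∀ e x → Closure E e x → ∃ λ t → ⟦ closureₑ eE e ⟧ₑ (pair x t) ≡ 0
  closure-complete e x (n , v , value , xEv) = pair (pair n (pair v u)) T ,
      trans (closureₑ-at eE e x (pair (pair n (pair v u)) T)) (trans (closureCheck′-pair eE e x n v u T) ok)
    where
    related : pair x v ∈W eE
    related = Equivalence.to (enumerates x v) xEv
    u : ℕ
    u = proj₁ related
    certificate : ∃ λ T → closureCheck eE e x n v u T ≡ 0
    certificate = closureCheck-complete eE e x n v u value (proj₂ related)
    T : ℕ
    T = proj₁ certificate
    ok : closureCheck eE e x n v u T ≡ 0
    ok = proj₂ certificate

  h : ℕ → ℕ
  h = ⟦ Muₑ (smnₑ (closureCheckₑ eE)) ⟧ₑ

  ∈W-h⇒Closure : ∀ e x → x ∈W h e → Closure E e x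
  ∈W-h⇒Closure e x x∈ = closure-sound e x (proj₁ zero-at) (proj₂ zero-at)
    where
    zero-at : ∃ λ t → ⟦ closureₑ eE e ⟧ₑ (pair x t) ≡ 0
    zero-at = mu-converges⇒zero (closureₑ eE e) x (subst (λ C → ∃ λ v → Evals C x v) (decode-muSmn (closureCheckₑ eE) e) x∈)

  Closure⇒∈W-h : ∀ e x → Closure E e x → x ∈W h e
  Closure⇒∈W-h e x c = subst (λ C → ∃ λ v → Evals C x v) (sym (decode-muSmn (closureCheckₑ eE) e))
                         (zero⇒mu-converges (closureₑ eE e) x (closure-complete e x c))

jump≤EqCE : ∀ E → IsCeer E → Jump E ≤c EqCE
jump≤EqCE E ceer = h , expr-computable (Muₑ (smnₑ (closureCheckₑ eE))) , λ e e′ → mk⇔ (to e e′) (from e e′)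
  where
  eE : ℕ
  eE = proj₁ (IsCeer.isCE ceer)
  open ClosureIndex E eE (proj₂ (IsCeer.isCE ceer))
  open ClosureFacts E (IsCeer.isEquivalence ceer)

  to : ∀ e e′ → Jump E e e′ → EqCE (h e) (h e′)
  to e e′ jump x = mk⇔ (λ x∈ → Closure⇒∈W-h e′ x (jump⇒⊆ e e′ x jump (∈W-h⇒Closure e x x∈)))
                       (λ x∈ → Closure⇒∈W-h e x (jump⇒⊆ e′ e x (jump-sym e e′ jump) (∈W-h⇒Closure e′ x x∈)))

  from : ∀ e e′ → EqCE (h e) (h e′) → Jump E e e′
  from e e′ same = closures⇒jump e e′ λ x →
    mk⇔ (λ c → ∈W-h⇒Closure e′ x (Equivalence.to (same x) (Closure⇒∈W-h e x c)))
        (λ c → ∈W-h⇒Closure e x (Equivalence.from (same x) (Closure⇒∈W-h e′ x c)))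

-- =ᶜᵉ ≤ E⁺ whenever id ≤ E

module Restriction (f : ℕ → ℕ) (ef : ℕ) (f-evals : ∀ x → ef · x ⇓ f x) where

  gₑ : Expr
  gₑ = Compₑ (Compₑ (constₑ ef) (constₑ 3)) (Pairₑ (constₑ 2) idₑ)

  g : ℕ → ℕ
  g = ⟦ gₑ ⟧ₑ

  decode-g : ∀ e → decode (g e) ≡ restrict (decode ef) (decode e)
  decode-g e = trans (decode-Comp (⟦ Compₑ (constₑ ef) (constₑ 3) ⟧ₑ e) (⟦ Pairₑ (constₑ 2) idₑ ⟧ₑ e))
                     (cong₂ Comp (decode-Comp ef 3) (decode-Pair 2 e))

  g-sound : ∀ e n v → g e · n ⇓ v → n ∈W e × v ≡ f n
  g-sound e n v value = proj₁ restricted , evals-det (decode ef) n (proj₂ restricted) (f-evals n)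
    where
    restricted : (∃ λ w → Evals (decode e) n w) × Evals (decode ef) n v
    restricted = restrict-evals⁻¹ (decode ef) (decode e) n v (subst (λ C → Evals C n v) (decode-g e) value)

  g-complete : ∀ e n → n ∈W e → g e · n ⇓ f n
  g-complete e n (w , w-evals) =
    subst (λ C → Evals C n (f n)) (sym (decode-g e)) (restrict-evals (decode ef) (decode e) n w (f n) w-evals (f-evals n))

EqCE≤jump : ∀ E → (∀ {x} → E x x) → idℕ ≤c E → EqCE ≤c Jump E
EqCE≤jump E refl-E (f , (ef , f-evals) , reduces) = g , expr-computable gₑ , λ e e′ → mk⇔ (to e e′) (from e e′)
  where
  open Restriction f ef f-evals

  to : ∀ e e′ → EqCE e e′ → Jump E (g e) (g e′)
  to e e′ same = forth , back
    where
    forth : ∀ n v → g e · n ⇓ v → ∃ λ m → ∃ λ w → g e′ · m ⇓ w × E v w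
    forth n v value = let (n∈ , v≡) = g-sound e n v value in
      n , f n , g-complete e′ n (Equivalence.to (same n) n∈) , subst (λ z → E z (f n)) (sym v≡) refl-E
    back : ∀ m w → g e′ · m ⇓ w → ∃ λ n → ∃ λ v → g e · n ⇓ v × E v w
    back m w value = let (m∈ , w≡) = g-sound e′ m w value in
      m , f m , g-complete e m (Equivalence.from (same m) m∈) , subst (E (f m)) (sym w≡) refl-E

  -- Since f reduces id to E, the E-classes of the values determine the domain.
  from : ∀ e e′ → Jump E (g e) (g e′) → EqCE e e′
  from e e′ (forth , back) x = mk⇔ to′ from′
    where
    to′ : x ∈W e → x ∈W e′
    to′ x∈ = let (m , w , value , fxEw) = forth x (f x) (g-complete e x x∈)
                 (m∈ , w≡) = g-sound e′ m w value
             in subst (_∈W e′) (sym (Equivalence.from (reduces x m) (subst (E (f x)) w≡ fxEw))) m∈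
    from′ : x ∈W e′ → x ∈W e
    from′ x∈ = let (n , v , value , vEfx) = back x (f x) (g-complete e′ x x∈)
                   (n∈ , v≡) = g-sound e n v value
               in subst (_∈W e) (Equivalence.from (reduces n x) (subst (λ z → E z (f x)) v≡ vEfx)) n∈

proposition4p6 : (E : Rel ℕ 0ℓ) → IsCeer E → Light E → ¬ FinitelyManyClasses E → HighForJump E
proposition4p6 E ceer (inj₁ finite) infinite = ⊥-elim (infinite finite)
proposition4p6 E ceer (inj₂ id≤E)   _        =
  jump≤EqCE E ceer , EqCE≤jump E (IsEquivalence.refl (IsCeer.isEquivalence ceer)) id≤E
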